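{- Suppose $t, n_1, \ldots, n_t \in \mathbb{N}$, $t \geq 2$, and $n_i$ is even for each $i \in \{1,\ldots,t\}$. Let $s = \sum_{i=1}^t n_i/2$. If $\max_{i} n_i \leq s$, then $K_{n_1, \ldots, n_t}$ is not proportionally $s$-choosable. Consequently, $\chi_{pc}(K_{n_1, \ldots, n_t}) \geq 1 + \sum_{i=1}^t n_i/2$.
   Context: All graphs are finite and simple; $\mathbb{N}=\{1,2,3,\ldots\}$. $K_{n_1,\ldots,n_t}$ denotes the complete $t$-partite graph with partite sets of sizes $n_1,\ldots,n_t$. A list assignment $L$ for a graph $G$ assigns to each vertex $v$ a set $L(v)$ of colors; it is a $k$-assignment if $|L(v)|=k$ for all $v$. The palette is $\mathcal{L}=\bigcup_{v}L(v)$. A proper $L$-coloring is a proper coloring $f$ with $f(v)\in L(v)$ for all $v$. For $c\in\mathcal{L}$, $\eta(c)$ is the number of vertices $v$ with $c\in L(v)$. If $L$ is a $k$-assignment, a proper $L$-coloring $f$ is a proportional $L$-coloring if for every $c\in\mathcal{L}$, $|f^{ -1}(c)|\in\{\lfloor \eta(c)/k\rfloor,\lceil \eta(c)/k\rceil\}$. $G$ is proportionally $k$-choosable if it has a proportional $L$-coloring for every $k$-assignment $L$; $\chi_{pc}(G)$ is the smallest $k$ such that $G$ is proportionally $k$-choosable. -}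

module Defs where

open import Data.Nat using (ℕ; zero; suc; _+_; _/_; _≡ᵇ_; _≤_)
open import Data.Nat.Properties using (_≟_)
open import Data.Bool using (Bool; true; false; not; if_then_else_)
open import Data.Fin using (Fin; splitAt) renaming (_≟_ to _≟ᶠ_)
open import Data.Sum using (inj₁; inj₂)
open import Data.Vec using (Vec; []; _∷_; sum)
open import Data.List using (List; length)
open import Data.List.Membership.Propositional using (_∈_)
open import Data.List.Membership.DecPropositional _≟_ using (_∈?_)
open import Data.List.Relation.Unary.Unique.Propositional using (Unique)
open import Data.Product using (Σ; _×_; ∃)
open import Relation.Binary.PropositionalEquality using (_≡_; _≢_)
open import Relation.Nullary using (¬_; does)
open import Data.Sum using (_⊎_)

record Graph : Set where
  field
    N     : ℕ
    Adj   : Fin N → Fin N → Bool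
    sym   : ∀ u v → Adj u v ≡ Adj v u
    irref : ∀ v → Adj v v ≡ false
open Graph public

count : ∀ {N} → (Fin N → Bool) → ℕ
count {zero}  p = 0
count {suc N} p = (if p Fin.zero then 1 else 0) + count {N} (λ i → p (Fin.suc i))
  where import Data.Fin as Fin

-- Complete multipartite graph K_{n_1,...,n_t}.
-- Vertex set Fin (n_1 + ... + n_t); the first n_1 vertices form part 0, etc.

part : ∀ {t} (ns : Vec ℕ t) → Fin (sum ns) → Fin t
part (n ∷ ns) v with splitAt n v
... | inj₁ _ = Fin.zero where import Data.Fin as Fin
... | inj₂ w = Fin.suc (part ns w) where import Data.Fin as Fin

samePart : ∀ {t} (ns : Vec ℕ t) → Fin (sum ns) → Fin (sum ns) → Bool
samePart ns u v = does (part ns u ≟ᶠ part ns v)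

sym-lemma : ∀ {t} (ns : Vec ℕ t) u v → not (samePart ns u v) ≡ not (samePart ns v u)
sym-lemma ns u v with part ns u ≟ᶠ part ns v | part ns v ≟ᶠ part ns u
... | Relation.Nullary.yes _ | Relation.Nullary.yes _ = Relation.Binary.PropositionalEquality.refl
... | Relation.Nullary.no _  | Relation.Nullary.no _  = Relation.Binary.PropositionalEquality.refl
... | Relation.Nullary.yes p | Relation.Nullary.no q  = Data.Empty.⊥-elim (q (Relation.Binary.PropositionalEquality.sym p))
  where import Data.Empty
... | Relation.Nullary.no q  | Relation.Nullary.yes p = Data.Empty.⊥-elim (q (Relation.Binary.PropositionalEquality.sym p))
  where import Data.Empty

irref-lemma : ∀ {t} (ns : Vec ℕ t) v → not (samePart ns v v) ≡ false
irref-lemma ns v with part ns v ≟ᶠ part ns v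
... | Relation.Nullary.yes _ = Relation.Binary.PropositionalEquality.refl
... | Relation.Nullary.no q  = Data.Empty.⊥-elim (q Relation.Binary.PropositionalEquality.refl)
  where import Data.Empty

K : ∀ {t} → Vec ℕ t → Graph
K ns = record
  { N     = sum ns
  ; Adj   = λ u v → not (samePart ns u v)
  ; sym   = sym-lemma ns
  ; irref = irref-lemma ns }

record Assignment (G : Graph) (k : ℕ) : Set where
  field
    L      : Fin (N G) → List ℕ
    unique : ∀ v → Unique (L v)
    size   : ∀ v → length (L v) ≡ k
open Assignment public

InPalette : ∀ {G k} → Assignment G k → ℕ → Set
InPalette {G} A c = Σ (Fin (N G)) λ v → c ∈ L A v

η : ∀ {G k} → Assignment G k → ℕ → ℕ
η {G} A c = count {N G} (λ v → does (c ∈? L A v))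

preimageSize : ∀ {G : Graph} → (Fin (N G) → ℕ) → ℕ → ℕ
preimageSize {G} f c = count {N G} (λ v → f v ≡ᵇ c)

-- floor / ceiling of m / k  (k = 0 is an irrelevant convention: value 0)
floorDiv : ℕ → ℕ → ℕ
floorDiv m zero    = 0
floorDiv m (suc k) = m / suc k

ceilDiv : ℕ → ℕ → ℕ
ceilDiv m zero    = 0
ceilDiv m (suc k) = (m + k) / suc k

IsProperLColoring : ∀ {G k} → Assignment G k → (Fin (N G) → ℕ) → Set
IsProperLColoring {G} A f =
  (∀ v → f v ∈ L A v) × (∀ u v → Adj G u v ≡ true → f u ≢ f v)

IsProportionalLColoring : ∀ {G k} → Assignment G k → (Fin (N G) → ℕ) → Set
IsProportionalLColoring {G} {k} A f =
  IsProperLColoring A f ×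
  (∀ c → InPalette A c →
     (preimageSize {G} f c ≡ floorDiv (η A c) k) ⊎ (preimageSize {G} f c ≡ ceilDiv (η A c) k))

ProportionallyChoosable : Graph → ℕ → Set
ProportionallyChoosable G k =
  ∀ (A : Assignment G k) → Σ (Fin (N G) → ℕ) λ f → IsProportionalLColoring A f

χpc≥ : Graph → ℕ → Set
χpc≥ G m = ∀ k → ProportionallyChoosable G k → m ≤ k

module Submission where

-- Proportional choosability is not known to be monotone in k here, so we show
-- that K is not proportionally k-choosable for every k ≤ s.  For k = 0 the
-- empty lists admit no colouring.  For k ≥ 1 we build k-assignments in which
-- every colour below a bound d lies on exactly 2k lists, so a proportional
-- colouring uses it exactly twice, and in a complete multipartite graph both
-- uses lie in one part: every part contains an even number of low-coloured
-- vertices.  The assignment also singles out a part i and a window W holding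
-- all low-coloured vertices such that i ∩ W is even but exactly one vertex of
-- i ∩ W has a high colour — a parity contradiction (parity-obstruction).

open import Defs hiding (sym)
open import Data.Nat using (ℕ; zero; suc; _+_; _*_; _∸_; _/_; _⊓_; _≤_; _<_; z≤n; s≤s; _<?_; _≤?_)
open import Data.Nat.Properties
open import Data.Bool using (true; not)
open import Data.Empty using (⊥; ⊥-elim)
open import Data.Fin using (Fin; toℕ) renaming (zero to fzero; suc to fsuc)
open import Data.Product using (∃; _×_; _,_; proj₁; proj₂)
open import Data.Sum using (_⊎_; inj₁; inj₂; [_,_]′)
open import Relation.Binary.PropositionalEquality
open import Relation.Binary.Definitions using (tri<; tri≈; tri>)
open import Relation.Nullary using (¬_; Dec; yes; no; does)
open import Relation.Nullary.Decidable using (_×-dec_)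
open import Relation.Unary using (Pred; Decidable; _∪_)
open import Relation.Unary.Properties using (_∩?_; _∪?_; ∁?; U?)
open import Level using (0ℓ)
open import Data.Nat.DivMod using (m*[n/m]≡n; m*n/n≡m; m<n⇒m/n≡0; +-distrib-/-∣ˡ; /-monoˡ-≤)
open import Data.List using (List; []; _∷_; upTo; length)
import Data.List as List
open import Algebra.Properties.CommutativeSemigroup +-commutativeSemigroup using (interchange)
open import Data.List.Properties using (length-map; length-upTo)
open import Data.List.Membership.Propositional using (_∈_)
open import Data.List.Membership.Propositional.Properties using (∈-map⁻; ∈-map⁺; ∈-upTo⁺; ∈-upTo⁻)
open import Data.List.Relation.Unary.Unique.Propositional using (Unique)
open import Data.List.Relation.Unary.AllPairs using ([]; _∷_)
open import Data.List.Relation.Unary.Any using (here; there)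
import Data.List.Relation.Unary.All as All
open import Data.List.Relation.Unary.Unique.Propositional.Properties using (map⁺; upTo⁺)
open import Data.List.Membership.DecPropositional _≟_ using (_∈?_)
open import Data.Nat.Divisibility using (_∣_; divides; n∣m*n; _∣0; ∣-refl; ∣1⇒≡1; ∣m+n∣m⇒∣n; ∣m∣n⇒∣m+n)
open import Data.Vec using (Vec; []; _∷_; sum; lookup; map)
open import Data.Fin using (fromℕ<; splitAt) renaming (_≟_ to _≟ᶠ_)
open import Data.Fin.Properties using (any?; toℕ-injective; splitAt⁻¹-↑ˡ; splitAt⁻¹-↑ʳ; toℕ-↑ˡ; toℕ-↑ʳ; toℕ<n)

#[_] : ∀ {N} {P : Pred (Fin N) 0ℓ} → Decidable P → ℕ
#[ P? ] = count (λ v → does (P? v))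

#-mono : ∀ {N} {P Q : Pred (Fin N) 0ℓ} (P? : Decidable P) (Q? : Decidable Q) →
         (∀ v → P v → Q v) → #[ P? ] ≤ #[ Q? ]
#-mono {zero}  P? Q? P⊆Q = z≤n
#-mono {suc N} P? Q? P⊆Q with P? fzero | Q? fzero
... | yes _ | yes _ = s≤s (#-mono (λ v → P? (fsuc v)) (λ v → Q? (fsuc v)) (λ v → P⊆Q (fsuc v)))
... | yes p | no ¬q = ⊥-elim (¬q (P⊆Q fzero p))
... | no _  | yes _ = m≤n⇒m≤1+n (#-mono (λ v → P? (fsuc v)) (λ v → Q? (fsuc v)) (λ v → P⊆Q (fsuc v)))
... | no _  | no _  = #-mono (λ v → P? (fsuc v)) (λ v → Q? (fsuc v)) (λ v → P⊆Q (fsuc v))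

#-cong : ∀ {N} {P Q : Pred (Fin N) 0ℓ} (P? : Decidable P) (Q? : Decidable Q) →
         (∀ v → P v → Q v) → (∀ v → Q v → P v) → #[ P? ] ≡ #[ Q? ]
#-cong P? Q? P⊆Q Q⊆P = ≤-antisym (#-mono P? Q? P⊆Q) (#-mono Q? P? Q⊆P)

#-∪ : ∀ {N} {P Q : Pred (Fin N) 0ℓ} (P? : Decidable P) (Q? : Decidable Q) →
      (∀ v → P v → Q v → ⊥) → #[ P? ∪? Q? ] ≡ #[ P? ] + #[ Q? ]
#-∪ {zero}  P? Q? disj = refl
#-∪ {suc N} P? Q? disj with P? fzero | Q? fzero | #-∪ (λ v → P? (fsuc v)) (λ v → Q? (fsuc v)) (λ v → disj (fsuc v))
... | yes p | yes q | _  = ⊥-elim (disj fzero p q)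
... | yes _ | no _  | ih = cong suc ih
... | no _  | yes _ | ih = trans (cong suc ih) (sym (+-suc _ _))
... | no _  | no _  | ih = ih

#-split : ∀ {N} {P Q : Pred (Fin N) 0ℓ} (P? : Decidable P) (Q? : Decidable Q) →
          #[ P? ] ≡ #[ P? ∩? Q? ] + #[ P? ∩? ∁? Q? ]
#-split {P = P} {Q} P? Q? = trans (#-cong P? ((P? ∩? Q?) ∪? (P? ∩? ∁? Q?)) split join)
                      (#-∪ (P? ∩? Q?) (P? ∩? ∁? Q?) (λ v pq p¬q → proj₂ p¬q (proj₂ pq)))
  where
  split : ∀ v → P v → (P v × Q v) ⊎ (P v × ¬ Q v)
  split v p with Q? v
  ... | yes q = inj₁ (p , q)
  ... | no ¬q = inj₂ (p , ¬q)
  join : ∀ v → (P v × Q v) ⊎ (P v × ¬ Q v) → P v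
  join v (inj₁ (p , _)) = p
  join v (inj₂ (p , _)) = p

#-witness : ∀ {N} {P : Pred (Fin N) 0ℓ} (P? : Decidable P) → 0 < #[ P? ] → ∃ P
#-witness {zero}  P? ()
#-witness {suc N} P? pos with P? fzero
... | yes p = fzero , p
... | no _  = let (v , p) = #-witness (λ v → P? (fsuc v)) pos in fsuc v , p

#-pos : ∀ {N} {P : Pred (Fin N) 0ℓ} (P? : Decidable P) v → P v → 0 < #[ P? ]
#-pos P? fzero p with P? fzero
... | yes _ = s≤s z≤n
... | no ¬p = ⊥-elim (¬p p)
#-pos P? (fsuc v) p with P? fzero
... | yes _ = s≤s z≤n
... | no _  = #-pos (λ v → P? (fsuc v)) v p

#-none : ∀ {N} {P : Pred (Fin N) 0ℓ} (P? : Decidable P) → (∀ v → ¬ P v) → #[ P? ] ≡ 0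
#-none P? none = n≤0⇒n≡0 (≮⇒≥ (λ pos → let (v , p) = #-witness P? pos in none v p))

Interval : ∀ {N} → ℕ → ℕ → Pred (Fin N) 0ℓ
Interval a b v = a ≤ toℕ v × toℕ v < b

interval? : ∀ {N} a b → Decidable (Interval {N} a b)
interval? a b v = (a ≤? toℕ v) ×-dec (toℕ v <? b)

#-below : ∀ {N} b → b ≤ N → #[ (λ (v : Fin N) → toℕ v <? b) ] ≡ b
#-below {N} zero _      = #-none (λ (v : Fin N) → toℕ v <? 0) (λ v ())
#-below (suc b) (s≤s b≤N) = cong suc (#-below b b≤N)

#-interval : ∀ {N} a b → a ≤ b → b ≤ N → #[ interval? {N} a b ] ≡ b ∸ a
#-interval {N} a b a≤b b≤N = begin
  #[ I ]                                                  ≡⟨ m+n∸n≡m _ a ⟨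
  #[ I ] + a ∸ a                                          ≡⟨ cong (_∸ a) (cong₂ _+_ inside outside) ⟩
  #[ below? b ∩? atLeast? ] + #[ below? b ∩? ∁? atLeast? ] ∸ a ≡⟨ cong (_∸ a) (#-split (below? b) atLeast?) ⟨
  #[ below? b ] ∸ a                                       ≡⟨ cong (_∸ a) (#-below b b≤N) ⟩
  b ∸ a                                                   ∎
  where
  open ≡-Reasoning
  I : Decidable (Interval {N} a b)
  I = interval? a b
  below? : ∀ c → Decidable (λ (v : Fin N) → toℕ v < c)
  below? c v = toℕ v <? c
  atLeast? : Decidable (λ (v : Fin N) → a ≤ toℕ v)
  atLeast? v = a ≤? toℕ v
  inside : #[ I ] ≡ #[ below? b ∩? atLeast? ]
  inside = #-cong I (below? b ∩? atLeast?) (λ _ (p , q) → q , p) (λ _ (p , q) → q , p)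
  outside : a ≡ #[ below? b ∩? ∁? atLeast? ]
  outside = trans (sym (#-below a (≤-trans a≤b b≤N)))
                  (#-cong (below? a) (below? b ∩? ∁? atLeast?)
                    (λ _ x<a → <-≤-trans x<a a≤b , <⇒≱ x<a) (λ _ (_ , a≰x) → ≰⇒> a≰x))

even+1-odd : ∀ {m} → 2 ∣ m → ¬ 2 ∣ m + 1
even+1-odd 2∣m 2∣m+1 with ∣1⇒≡1 (∣m+n∣m⇒∣n 2∣m+1 2∣m)
... | ()

even-or-odd : ∀ n → 2 ∣ n ⊎ 2 ∣ suc n
even-or-odd zero = inj₁ (2 ∣0)
even-or-odd (suc n) with even-or-odd n
... | inj₁ 2∣n   = inj₂ (∣m∣n⇒∣m+n (∣-refl {2}) 2∣n)
... | inj₂ 2∣1+n = inj₁ 2∣1+n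

even-double : ∀ n → 2 ∣ n + n
even-double n = divides n (trans (cong (n +_) (sym (*-identityʳ n))) (sym (*-suc n 1)))

even-∸ : ∀ {m n} → n ≤ m → 2 ∣ m → 2 ∣ n → 2 ∣ m ∸ n
even-∸ n≤m 2∣m 2∣n = ∣m+n∣m⇒∣n (subst (2 ∣_) (sym (m+[n∸m]≡n n≤m)) 2∣m) 2∣n

-- Part i of K ns occupies the vertices with index in [start ns i, end ns i).
start : ∀ {t} → Vec ℕ t → Fin t → ℕ
start (n ∷ ns) fzero    = 0
start (n ∷ ns) (fsuc i) = n + start ns i

end : ∀ {t} → Vec ℕ t → Fin t → ℕ
end ns i = start ns i + lookup ns i

end≤sum : ∀ {t} (ns : Vec ℕ t) i → end ns i ≤ sum ns
end≤sum (n ∷ ns) fzero    = m≤m+n n _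
end≤sum (n ∷ ns) (fsuc i) = ≤-trans (≤-reflexive (+-assoc n _ _)) (+-monoʳ-≤ n (end≤sum ns i))

toℕ-splitAt-inj₁ : ∀ n {m} {v : Fin (n + m)} {x} → splitAt n v ≡ inj₁ x → toℕ v ≡ toℕ x
toℕ-splitAt-inj₁ n {m} {x = x} eq = trans (cong toℕ (sym (splitAt⁻¹-↑ˡ eq))) (toℕ-↑ˡ x m)

toℕ-splitAt-inj₂ : ∀ n {m} {v : Fin (n + m)} {w} → splitAt n v ≡ inj₂ w → toℕ v ≡ n + toℕ w
toℕ-splitAt-inj₂ n {w = w} eq = trans (cong toℕ (sym (splitAt⁻¹-↑ʳ eq))) (toℕ-↑ʳ n w)

part-in-block : ∀ {t} (ns : Vec ℕ t) v → Interval (start ns (part ns v)) (end ns (part ns v)) v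
part-in-block (n ∷ ns) v with splitAt n v in eq
... | inj₁ x rewrite toℕ-splitAt-inj₁ n eq = z≤n , toℕ<n x
... | inj₂ w rewrite toℕ-splitAt-inj₂ n eq with part-in-block ns w
... | lo , hi = +-monoʳ-≤ n lo , subst (n + toℕ w <_) (sym (+-assoc n _ _)) (+-monoʳ-< n hi)

block-in-part : ∀ {t} (ns : Vec ℕ t) i v → Interval (start ns i) (end ns i) v → part ns v ≡ i
block-in-part (n ∷ ns) i v (lo , hi) with splitAt n v in eq
block-in-part (n ∷ ns) fzero    v _ | inj₁ x = refl
block-in-part (n ∷ ns) (fsuc i) v (lo , hi) | inj₁ x rewrite toℕ-splitAt-inj₁ n eq =
  ⊥-elim (<⇒≱ (toℕ<n x) (≤-trans (m≤m+n n _) lo))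
block-in-part (n ∷ ns) fzero    v (lo , hi) | inj₂ w rewrite toℕ-splitAt-inj₂ n eq =
  ⊥-elim (<⇒≱ hi (m≤m+n n _))
block-in-part (n ∷ ns) (fsuc i) v (lo , hi) | inj₂ w rewrite toℕ-splitAt-inj₂ n eq =
  cong fsuc (block-in-part ns i w (+-cancelˡ-≤ n _ _ lo , +-cancelˡ-< n _ _ (subst (n + toℕ w <_) (+-assoc n _ _) hi)))

InPart : ∀ {t} (ns : Vec ℕ t) → Fin t → Pred (Fin (sum ns)) 0ℓ
InPart ns i v = part ns v ≡ i

inPart? : ∀ {t} (ns : Vec ℕ t) i → Decidable (InPart ns i)
inPart? ns i v = part ns v ≟ᶠ i

inPart⇒block : ∀ {t} (ns : Vec ℕ t) {i} v → InPart ns i v → Interval (start ns i) (end ns i) v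
inPart⇒block ns v refl = part-in-block ns v

#-part : ∀ {t} (ns : Vec ℕ t) i → #[ inPart? ns i ] ≡ lookup ns i
#-part ns i = begin
  #[ inPart? ns i ]                   ≡⟨ #-cong (inPart? ns i) (interval? (start ns i) (end ns i))
                                                (inPart⇒block ns) (block-in-part ns i) ⟩
  #[ interval? {sum ns} (start ns i) (end ns i) ] ≡⟨ #-interval (start ns i) (end ns i) (m≤m+n _ _) (end≤sum ns i) ⟩
  end ns i ∸ start ns i                ≡⟨ m+n∸m≡n (start ns i) (lookup ns i) ⟩
  lookup ns i                          ∎
  where open ≡-Reasoning

even-start : ∀ {t} (ns : Vec ℕ t) → (∀ i → 2 ∣ lookup ns i) → ∀ i → 2 ∣ start ns i
even-start (n ∷ ns) even fzero    = 2 ∣0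
even-start (n ∷ ns) even (fsuc i) = ∣m∣n⇒∣m+n (even fzero) (even-start ns (λ j → even (fsuc j)) i)

even-part-prefix : ∀ {t} (ns : Vec ℕ t) → (∀ i → 2 ∣ lookup ns i) → ∀ i {b} → 2 ∣ b →
                   2 ∣ #[ inPart? ns i ∩? (λ v → toℕ v <? b) ]
even-part-prefix ns even i {b} 2∣b with b ≤? start ns i | end ns i ≤? b
... | yes b≤start | _ = subst (2 ∣_) (sym (#-none (inPart? ns i ∩? (λ v → toℕ v <? b)) disjoint)) (2 ∣0)
  where
  disjoint : ∀ v → ¬ (InPart ns i v × toℕ v < b)
  disjoint v (refl , v<b) = <⇒≱ (<-≤-trans v<b b≤start) (proj₁ (part-in-block ns v))
... | no _ | yes end≤b = subst (2 ∣_) (sym (trans whole (#-part ns i))) (even i)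
  where
  whole : #[ inPart? ns i ∩? (λ v → toℕ v <? b) ] ≡ #[ inPart? ns i ]
  whole = #-cong (inPart? ns i ∩? (λ v → toℕ v <? b)) (inPart? ns i) (λ _ → proj₁)
            (λ v eq → eq , <-≤-trans (proj₂ (inPart⇒block ns v eq)) end≤b)
... | no b≰start | no end≰b = subst (2 ∣_) (sym (trans cut (#-interval (start ns i) b (<⇒≤ (≰⇒> b≰start)) b≤N)))
                                (even-∸ (<⇒≤ (≰⇒> b≰start)) 2∣b (even-start ns even i))
  where
  b≤N : b ≤ sum ns
  b≤N = ≤-trans (<⇒≤ (≰⇒> end≰b)) (end≤sum ns i)
  cut : #[ inPart? ns i ∩? (λ v → toℕ v <? b) ] ≡ #[ interval? {sum ns} (start ns i) b ]
  cut = #-cong (inPart? ns i ∩? (λ v → toℕ v <? b)) (interval? (start ns i) b)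
          (λ v (eq , v<b) → proj₁ (inPart⇒block ns v eq) , v<b)
          (λ v (lo , v<b) → block-in-part ns i v (lo , <-trans v<b (≰⇒> end≰b)) , v<b)

module ColourClasses {N : ℕ} (f : Fin N → ℕ) where

  colour? : ∀ c → Decidable (λ v → f v ≡ c)
  colour? c v = f v ≟ c

  below? : ∀ d → Decidable (λ v → f v < d)
  below? d v = f v <? d

  #-below-suc : ∀ {P} (P? : Decidable P) d →
                #[ P? ∩? below? (suc d) ] ≡ #[ P? ∩? below? d ] + #[ P? ∩? colour? d ]
  #-below-suc {P} P? d =
    trans (#-cong (P? ∩? below? (suc d)) ((P? ∩? below? d) ∪? (P? ∩? colour? d)) split join)
          (#-∪ (P? ∩? below? d) (P? ∩? colour? d) (λ v (_ , lt) (_ , eq) → <-irrefl eq lt))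
    where
    split : ∀ v → P v × f v < suc d → (P v × f v < d) ⊎ (P v × f v ≡ d)
    split v (p , lt) with m≤n⇒m<n∨m≡n (≤-pred lt)
    ... | inj₁ f<d = inj₁ (p , f<d)
    ... | inj₂ f≡d = inj₂ (p , f≡d)
    join : ∀ v → (P v × f v < d) ⊎ (P v × f v ≡ d) → P v × f v < suc d
    join v (inj₁ (p , f<d)) = p , m≤n⇒m≤1+n f<d
    join v (inj₂ (p , f≡d)) = p , s≤s (≤-reflexive f≡d)

  #-paired-below : ∀ d → (∀ j → j < d → #[ colour? j ] ≡ 2) → #[ below? d ] ≡ d + d
  #-paired-below zero    twice = #-none (below? 0) (λ v ())
  #-paired-below (suc d) twice = begin
    #[ U? ∩? below? (suc d) ]                      ≡⟨ #-below-suc U? d ⟩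
    #[ below? d ] + #[ colour? d ]                  ≡⟨ cong₂ _+_ (#-paired-below d (λ j j<d → twice j (m≤n⇒m≤1+n j<d))) (twice d ≤-refl) ⟩
    d + d + 2                                       ≡⟨ +-comm (d + d) 2 ⟩
    suc (suc (d + d))                               ≡⟨ cong suc (+-suc d d) ⟨
    suc d + suc d                                   ∎
    where open ≡-Reasoning

  even-paired-below : ∀ {P} (P? : Decidable P) → (∀ u v → P u → f u ≡ f v → P v) →
                      ∀ d → (∀ j → j < d → #[ colour? j ] ≡ 2) → 2 ∣ #[ P? ∩? below? d ]
  even-paired-below P? closed zero    twice = subst (2 ∣_) (sym (#-none (P? ∩? below? 0) (λ v ()))) (2 ∣0)
  even-paired-below P? closed (suc d) twice =
    subst (2 ∣_) (sym (#-below-suc P? d))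
      (∣m∣n⇒∣m+n (even-paired-below P? closed d (λ j j<d → twice j (m≤n⇒m≤1+n j<d))) class-even)
    where
    class-even : 2 ∣ #[ P? ∩? colour? d ]
    class-even with 0 <? #[ P? ∩? colour? d ]
    ... | no empty = subst (2 ∣_) (sym (n≤0⇒n≡0 (≮⇒≥ empty))) (2 ∣0)
    ... | yes nonempty with #-witness (P? ∩? colour? d) nonempty
    ... | u , Pu , fu≡d = subst (2 ∣_) (sym (trans whole-class (twice d ≤-refl))) ∣-refl
      where
      whole-class : #[ P? ∩? colour? d ] ≡ #[ colour? d ]
      whole-class = #-cong (P? ∩? colour? d) (colour? d) (λ _ → proj₂)
                      (λ v fv≡d → closed u v Pu (trans fu≡d (sym fv≡d)) , fv≡d)

Proper : (G : Graph) → (Fin (N G) → ℕ) → Set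
Proper G f = ∀ u v → Adj G u v ≡ true → f u ≢ f v

same-colour-same-part : ∀ {t} (ns : Vec ℕ t) {f} → Proper (K ns) f →
                        ∀ u v → f u ≡ f v → part ns u ≡ part ns v
same-colour-same-part ns proper u v fu≡fv with part ns u ≟ᶠ part ns v in eq
... | yes same = same
... | no _     = ⊥-elim (proper u v (cong (λ d → not (does d)) eq) fu≡fv)

-- Then part i cannot
-- meet W in an even number of vertices of which exactly one has colour ≥ d:
-- the low-coloured ones come in pairs inside part i.
parity-obstruction : ∀ {t} (ns : Vec ℕ t) {f} → Proper (K ns) f → let open ColourClasses f in
  ∀ d → (∀ j → j < d → #[ colour? j ] ≡ 2) →
  ∀ i {W} (W? : Decidable W) → (∀ v → f v < d → W v) →
  2 ∣ #[ inPart? ns i ∩? W? ] → #[ (inPart? ns i ∩? W?) ∩? ∁? (below? d) ] ≡ 1 → ⊥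
parity-obstruction ns {f} proper d twice i W? low⊆W even-PiW one-high =
  even+1-odd even-low (subst (2 ∣_) split-PiW even-PiW)
  where
  open ColourClasses f
  even-low : 2 ∣ #[ inPart? ns i ∩? below? d ]
  even-low = even-paired-below (inPart? ns i)
               (λ u v u∈i fu≡fv → trans (sym (same-colour-same-part ns proper u v fu≡fv)) u∈i) d twice
  low-in-W : #[ (inPart? ns i ∩? W?) ∩? below? d ] ≡ #[ inPart? ns i ∩? below? d ]
  low-in-W = #-cong ((inPart? ns i ∩? W?) ∩? below? d) (inPart? ns i ∩? below? d)
               (λ _ ((v∈i , _) , low) → v∈i , low) (λ v (v∈i , low) → (v∈i , low⊆W v low) , low)
  split-PiW : #[ inPart? ns i ∩? W? ] ≡ #[ inPart? ns i ∩? below? d ] + 1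
  split-PiW = trans (#-split (inPart? ns i ∩? W?) (below? d)) (cong₂ _+_ low-in-W one-high)

ceil-of-multiple : ∀ q k′ → (q * suc k′ + k′) / suc k′ ≡ q
ceil-of-multiple q k′ = begin
  (q * suc k′ + k′) / suc k′            ≡⟨ +-distrib-/-∣ˡ k′ (n∣m*n q) ⟩
  q * suc k′ / suc k′ + k′ / suc k′     ≡⟨ cong₂ _+_ (m*n/n≡m q (suc k′)) (m<n⇒m/n≡0 (n<1+n k′)) ⟩
  q + 0                                 ≡⟨ +-identityʳ q ⟩
  q                                     ∎
  where open ≡-Reasoning

module Proportional {G : Graph} {k′ : ℕ} (A : Assignment G (suc k′)) (f : Fin (N G) → ℕ)
                    (prop : IsProportionalLColoring A f) where
  open ColourClasses f public

  k : ℕ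
  k = suc k′

  list-coloured : ∀ v → f v ∈ L A v
  list-coloured = proj₁ (proj₁ prop)

  proper : Proper G f
  proper = proj₂ (proj₁ prop)

  holders? : ∀ c → Decidable (λ v → c ∈ L A v)
  holders? c v = c ∈? L A v

  used≤η : ∀ c → #[ colour? c ] ≤ η A c
  used≤η c = #-mono (colour? c) (holders? c) (λ v fv≡c → subst (_∈ L A v) fv≡c (list-coloured v))

  used≤ceil : ∀ c → #[ colour? c ] ≤ (η A c + k′) / k
  used≤ceil c with 0 <? η A c
  ... | no  unused = ≤-trans (used≤η c) (≤-trans (≮⇒≥ unused) z≤n)
  ... | yes listed with proj₂ prop c (#-witness (holders? c) listed)
  ...   | inj₁ floor = ≤-trans (≤-reflexive floor) (/-monoˡ-≤ k (m≤m+n (η A c) k′))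
  ...   | inj₂ ceil  = ≤-reflexive ceil

  floor≤used : ∀ c → 0 < η A c → η A c / k ≤ #[ colour? c ]
  floor≤used c listed with proj₂ prop c (#-witness (holders? c) listed)
  ... | inj₁ floor = ≤-reflexive (sym floor)
  ... | inj₂ ceil  = ≤-trans (/-monoˡ-≤ k (m≤m+n (η A c) k′)) (≤-reflexive (sym ceil))

  used-exactly : ∀ q c → η A c ≡ suc q * k → #[ colour? c ] ≡ suc q
  used-exactly q c η≡ = ≤-antisym
    (≤-trans (used≤ceil c) (≤-reflexive (trans (cong (λ x → (x + k′) / k) η≡) (ceil-of-multiple (suc q) k′))))
    (≤-trans (≤-reflexive (sym (trans (cong (_/ k) η≡) (m*n/n≡m (suc q) k)))) (floor≤used c (subst (0 <_) (sym η≡) (s≤s z≤n))))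

  used-once : ∀ c → η A c ≡ k → #[ colour? c ] ≡ 1
  used-once c η≡ = used-exactly 0 c (trans η≡ (sym (+-identityʳ k)))

  used-twice : ∀ c → η A c ≡ k + k → #[ colour? c ] ≡ 2
  used-twice c η≡ = used-exactly 1 c (trans η≡ (cong (k +_) (sym (+-identityʳ k))))

  used-at-most-once : ∀ c → η A c ≤ k → #[ colour? c ] ≤ 1
  used-at-most-once c η≤ = ≤-trans (used≤ceil c)
    (≤-trans (/-monoˡ-≤ k (+-monoˡ-≤ k′ η≤))
             (≤-reflexive (trans (cong (λ x → (x + k′) / k) (sym (+-identityʳ k))) (ceil-of-multiple 1 k′))))

colours-from : ℕ → ℕ → List ℕ
colours-from B k = List.map (B +_) (upTo k)

colours-from-unique : ∀ B k → Unique (colours-from B k)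
colours-from-unique B k = map⁺ (+-cancelˡ-≡ B _ _) (upTo⁺ k)

colours-from-length : ∀ B k → length (colours-from B k) ≡ k
colours-from-length B k = trans (length-map (B +_) (upTo k)) (length-upTo k)

∈-colours-from⁻ : ∀ {B k c} → c ∈ colours-from B k → B ≤ c
∈-colours-from⁻ {B} c∈ with ∈-map⁻ (B +_) c∈
... | x , _ , refl = m≤m+n B x

skip : ℕ → ℕ → ℕ
skip y j with j <? y
... | yes _ = j
... | no  _ = suc j

skip-below : ∀ {y j} → j < y → skip y j ≡ j
skip-below {y} {j} j<y with j <? y
... | yes _  = refl
... | no j≮y = ⊥-elim (j≮y j<y)

skip-above : ∀ {y j} → y ≤ j → skip y j ≡ suc j
skip-above {y} {j} y≤j with j <? y
... | yes j<y = ⊥-elim (<⇒≱ j<y y≤j)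
... | no  _   = refl

skip-injective : ∀ y {i j} → skip y i ≡ skip y j → i ≡ j
skip-injective y {i} {j} eq with i <? y | j <? y
... | yes _   | yes _   = eq
... | no  _   | no  _   = suc-injective eq
... | yes i<y | no  j≮y = ⊥-elim (j≮y (<-trans (n<1+n j) (subst (_< y) eq i<y)))
... | no  i≮y | yes j<y = ⊥-elim (i≮y (<-trans (n<1+n i) (subst (_< y) (sym eq) j<y)))

all-but : ℕ → ℕ → List ℕ
all-but k′ y = List.map (skip y) (upTo k′)

all-but-unique : ∀ k′ y → Unique (all-but k′ y)
all-but-unique k′ y = map⁺ (skip-injective y) (upTo⁺ k′)

all-but-length : ∀ k′ y → length (all-but k′ y) ≡ k′
all-but-length k′ y = trans (length-map (skip y) (upTo k′)) (length-upTo k′)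

∈-all-but⁻ : ∀ {k′ y j} → j ∈ all-but k′ y → j < suc k′ × j ≢ y
∈-all-but⁻ {k′} {y} j∈ with ∈-map⁻ (skip y) j∈
... | i , i∈ , refl with i <? y
...   | yes i<y = m≤n⇒m≤1+n (∈-upTo⁻ i∈) , <⇒≢ i<y
...   | no  i≮y = s≤s (∈-upTo⁻ i∈) , λ 1+i≡y → i≮y (subst (i <_) 1+i≡y (n<1+n i))

∈-all-but⁺ : ∀ {k′ y j} → y < suc k′ → j < suc k′ → j ≢ y → j ∈ all-but k′ y
∈-all-but⁺ {k′} {y} {j} y≤k′ j≤k′ j≢y with <-cmp j y
... | tri< j<y _ _ = subst (_∈ all-but k′ y) (skip-below j<y) (∈-map⁺ (skip y) (∈-upTo⁺ (<-≤-trans j<y (≤-pred y≤k′))))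
... | tri≈ _ j≡y _ = ⊥-elim (j≢y j≡y)
∈-all-but⁺ {k′} {y} {suc i} y≤k′ j≤k′ j≢y | tri> _ _ y<j =
  subst (_∈ all-but k′ y) (skip-above (≤-pred y<j)) (∈-map⁺ (skip y) (∈-upTo⁺ (≤-pred j≤k′)))


-- The window W consists of the first 2k vertices; a vertex
-- of part i in W gets the colours 0, …, k′ − 1 together with the colour k + i of
-- its part, and every vertex outside W gets k fresh colours.  Each colour j < k′
-- then lies on exactly 2k lists and must be used twice, so some window vertex u
-- receives the colour of its part i; that colour lies on at most n_i ≤ k lists,
-- so u is its only vertex in part i ∩ W, while part i meets W evenly.
module SmallParts {t : ℕ} (ns : Vec ℕ t) (k′ : ℕ)
                  (small : ∀ i → lookup ns i ≤ suc k′) (even : ∀ i → 2 ∣ lookup ns i)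
                  (room : suc k′ + suc k′ ≤ sum ns) where

  k : ℕ
  k = suc k′

  Window : Pred (Fin (sum ns)) 0ℓ
  Window v = toℕ v < k + k

  window? : Decidable Window
  window? v = toℕ v <? k + k

  part-colour : Fin t → ℕ
  part-colour i = k + toℕ i

  lists : Fin (sum ns) → List ℕ
  lists v with window? v
  ... | yes _ = part-colour (part ns v) ∷ upTo k′
  ... | no  _ = colours-from (k + t) k

  assignment : Assignment (K ns) k
  assignment = record { L = lists ; unique = lists-unique ; size = lists-size }
    where
    lists-unique : ∀ v → Unique (lists v)
    lists-unique v with window? v
    ... | yes _ = All.tabulate (λ j∈ eq → <-irrefl (sym eq) (<-≤-trans (m≤n⇒m≤1+n (∈-upTo⁻ j∈)) (m≤m+n k _)))
                  ∷ upTo⁺ k′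
    ... | no  _ = colours-from-unique (k + t) k
    lists-size : ∀ v → length (lists v) ≡ k
    lists-size v with window? v
    ... | yes _ = cong suc (length-upTo k′)
    ... | no  _ = colours-from-length (k + t) k

  list-colours : ∀ v {c} → c ∈ lists v →
                 (Window v × (c ≡ part-colour (part ns v) ⊎ c < k′)) ⊎ (¬ Window v × k + t ≤ c)
  list-colours v c∈ with window? v
  list-colours v (here eq)  | yes w  = inj₁ (w , inj₁ eq)
  list-colours v (there c∈) | yes w  = inj₁ (w , inj₂ (∈-upTo⁻ c∈))
  list-colours v c∈         | no  ¬w = inj₂ (¬w , ∈-colours-from⁻ c∈)

  low-on-window-lists : ∀ v {j} → Window v → j < k′ → j ∈ lists v
  low-on-window-lists v w j<k′ with window? v
  ... | yes _ = there (∈-upTo⁺ j<k′)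
  ... | no ¬w = ⊥-elim (¬w w)

  low<fresh : ∀ {j c} → j < k′ → k + t ≤ c → j < c
  low<fresh j<k′ k+t≤c = <-≤-trans j<k′ (≤-trans (n≤1+n k′) (≤-trans (m≤m+n k t) k+t≤c))

  module _ (f : Fin (sum ns) → ℕ) (prop : IsProportionalLColoring assignment f) where
    open Proportional assignment f prop hiding (k)

    used-twice-low : ∀ j → j < k′ → #[ colour? j ] ≡ 2
    used-twice-low j j<k′ = used-twice j (trans (#-cong (holders? j) window? on-window (λ v w → low-on-window-lists v w j<k′))
                                                (#-below (k + k) room))
      where
      on-window : ∀ v → j ∈ lists v → Window v
      on-window v j∈ with list-colours v j∈
      ... | inj₁ (w , _)     = w
      ... | inj₂ (_ , fresh) = ⊥-elim (<-irrefl refl (low<fresh j<k′ fresh))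

    low-in-window : ∀ v → f v < k′ → Window v
    low-in-window v low with list-colours v (list-coloured v)
    ... | inj₁ (w , _)     = w
    ... | inj₂ (_ , fresh) = ⊥-elim (<-irrefl refl (low<fresh low fresh))

    high-is-part-colour : ∀ v → Window v → ¬ f v < k′ → f v ≡ part-colour (part ns v)
    high-is-part-colour v w high with list-colours v (list-coloured v)
    ... | inj₁ (_ , inj₁ eq)  = eq
    ... | inj₁ (_ , inj₂ low) = ⊥-elim (high low)
    ... | inj₂ (¬w , _)       = ⊥-elim (¬w w)

    -- At most 2k′ of the 2k window vertices have a low colour.
    high-in-window : 0 < #[ window? ∩? ∁? (below? k′) ]
    high-in-window = +-cancelˡ-< (k′ + k′) 0 _ (begin-strict
      k′ + k′ + 0                                               ≡⟨ +-identityʳ _ ⟩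
      k′ + k′                                                   <⟨ +-mono-< (n<1+n k′) (n<1+n k′) ⟩
      k + k                                                     ≡⟨ #-below (k + k) room ⟨
      #[ window? ]                                              ≡⟨ #-split window? (below? k′) ⟩
      #[ window? ∩? below? k′ ] + #[ window? ∩? ∁? (below? k′) ] ≤⟨ +-monoˡ-≤ _ low-bound ⟩
      k′ + k′ + #[ window? ∩? ∁? (below? k′) ]                  ∎)
      where
      open ≤-Reasoning
      low-bound : #[ window? ∩? below? k′ ] ≤ k′ + k′
      low-bound = ≤-trans (#-mono (window? ∩? below? k′) (below? k′) (λ _ → proj₂))
                          (≤-reflexive (#-paired-below k′ used-twice-low))

    contradiction : ⊥
    contradiction with #-witness (window? ∩? ∁? (below? k′)) high-in-window
    ... | u , u∈W , high = parity-obstruction ns proper k′ used-twice-low i window? low-in-window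
                             (even-part-prefix ns even i (even-double k)) one-high
      where
      i : Fin t
      i = part ns u
      holders-in-part : ∀ v → part-colour i ∈ lists v → InPart ns i v
      holders-in-part v c∈ with list-colours v c∈
      ... | inj₁ (_ , inj₁ eq)  = sym (toℕ-injective (+-cancelˡ-≡ k _ _ eq))
      ... | inj₁ (_ , inj₂ low) = ⊥-elim (<-irrefl refl (<-≤-trans low (≤-trans (n≤1+n k′) (m≤m+n k _))))
      ... | inj₂ (_ , fresh)    = ⊥-elim (<⇒≱ (+-monoʳ-< k (toℕ<n i)) fresh)
      part-colour-once : #[ colour? (part-colour i) ] ≤ 1
      part-colour-once = used-at-most-once (part-colour i)
        (≤-trans (#-mono (holders? (part-colour i)) (inPart? ns i) holders-in-part) (≤-trans (≤-reflexive (#-part ns i)) (small i)))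
      one-high : #[ (inPart? ns i ∩? window?) ∩? ∁? (below? k′) ] ≡ 1
      one-high = ≤-antisym
        (≤-trans (#-mono ((inPart? ns i ∩? window?) ∩? ∁? (below? k′)) (colour? (part-colour i))
                   (λ v ((v∈i , w) , high) → trans (high-is-part-colour v w high) (cong part-colour v∈i)))
                 part-colour-once)
        (#-pos ((inPart? ns i ∩? window?) ∩? ∁? (below? k′)) u ((refl , u∈W) , high))

  not-choosable : ¬ ProportionallyChoosable (K ns) k
  not-choosable choosable = contradiction (proj₁ (choosable assignment)) (proj₂ (choosable assignment))

-- Second construction: part P has at least k + e vertices (k = k′ + 1), where
-- k + e is even, and at least m = k + 1 − e vertices lie outside P.  The first
-- k vertices of P form the head; the next e vertices of P (the tail) together
-- with m vertices outside P (the outer vertices) form the k + 1 filler vertices.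
-- The y-th head vertex gets the colour k and the colours 0, …, k − 1 except y;
-- filler vertices get 0, …, k − 1; all other vertices get k fresh colours.  Then
-- k lies on k lists and every j < k on (k − 1) + (k + 1) = 2k lists, so k is used
-- once (on a head vertex) and each j < k twice; but part P meets the window
-- head ∪ filler in k + e vertices, an even number.
module BigPart {t : ℕ} (ns : Vec ℕ t) (P : Fin t) (k′ e m : ℕ)
               (e+m≡k+1 : e + m ≡ suc (suc k′)) (fits : suc k′ + e ≤ lookup ns P)
               (outside : m + lookup ns P ≤ sum ns) (even : 2 ∣ suc k′ + e) where

  k : ℕ
  k = suc k′

  s₀ e₀ : ℕ
  s₀ = start ns P
  e₀ = end ns P

  Head Tail Before After Outer Filler Window : Pred (Fin (sum ns)) 0ℓ
  Head   = Interval s₀ (s₀ + k)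
  Tail   = Interval (s₀ + k) (s₀ + k + e)
  Before = Interval 0 (s₀ ⊓ m)
  After  = Interval e₀ (e₀ + (m ∸ s₀))
  Outer  = Before ∪ After
  Filler = Tail ∪ Outer
  Window = Head ∪ Filler

  head? : Decidable Head
  head? = interval? s₀ (s₀ + k)
  tail? : Decidable Tail
  tail? = interval? (s₀ + k) (s₀ + k + e)
  before? : Decidable Before
  before? = interval? 0 (s₀ ⊓ m)
  after? : Decidable After
  after? = interval? e₀ (e₀ + (m ∸ s₀))
  outer? : Decidable Outer
  outer? = before? ∪? after?
  filler? : Decidable Filler
  filler? = tail? ∪? outer?
  window? : Decidable Window
  window? = head? ∪? filler?

  head-tail≤end : s₀ + k + e ≤ e₀
  head-tail≤end = ≤-trans (≤-reflexive (+-assoc s₀ k e)) (+-monoʳ-≤ s₀ fits)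

  outer≤sum : e₀ + (m ∸ s₀) ≤ sum ns
  outer≤sum with ≤-total m s₀
  ... | inj₁ m≤s₀ = subst (_≤ sum ns) (sym (trans (cong (e₀ +_) (m≤n⇒m∸n≡0 m≤s₀)) (+-identityʳ e₀))) (end≤sum ns P)
  ... | inj₂ s₀≤m = subst (_≤ sum ns) (sym rearrange) (subst (_≤ sum ns) (+-comm m _) outside)
    where
    rearrange : e₀ + (m ∸ s₀) ≡ lookup ns P + m
    rearrange = trans (cong (_+ (m ∸ s₀)) (+-comm s₀ (lookup ns P)))
                      (trans (+-assoc (lookup ns P) s₀ _) (cong (lookup ns P +_) (m+[n∸m]≡n s₀≤m)))

  head-in-P : ∀ v → Head v → InPart ns P v
  head-in-P v (lo , hi) = block-in-part ns P v (lo , <-≤-trans hi (≤-trans (m≤m+n (s₀ + k) e) head-tail≤end))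

  tail-in-P : ∀ v → Tail v → InPart ns P v
  tail-in-P v (lo , hi) = block-in-part ns P v (≤-trans (m≤m+n s₀ k) lo , <-≤-trans hi head-tail≤end)

  outer-outside-P : ∀ v → Outer v → ¬ InPart ns P v
  outer-outside-P v (inj₁ (_ , hi)) v∈P = <⇒≱ (<-≤-trans hi (m⊓n≤m s₀ m)) (proj₁ (inPart⇒block ns v v∈P))
  outer-outside-P v (inj₂ (lo , _)) v∈P = <⇒≱ (proj₂ (inPart⇒block ns v v∈P)) lo

  head-not-filler : ∀ v → Head v → ¬ Filler v
  head-not-filler v (_ , hi) (inj₁ (lo , _)) = <⇒≱ hi lo
  head-not-filler v h        (inj₂ outer)    = outer-outside-P v outer (head-in-P v h)

  #-head : #[ head? ] ≡ k
  #-head = trans (#-interval s₀ (s₀ + k) (m≤m+n s₀ k) (≤-trans (m≤m+n (s₀ + k) e) (≤-trans head-tail≤end (end≤sum ns P))))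
                 (m+n∸m≡n s₀ k)

  #-filler : #[ filler? ] ≡ suc k
  #-filler = begin
    #[ filler? ]              ≡⟨ #-∪ tail? outer? (λ v tail outer → outer-outside-P v outer (tail-in-P v tail)) ⟩
    #[ tail? ] + #[ outer? ]  ≡⟨ cong₂ _+_ #-tail #-outer ⟩
    e + m                     ≡⟨ e+m≡k+1 ⟩
    suc k                     ∎
    where
    open ≡-Reasoning
    #-tail : #[ tail? ] ≡ e
    #-tail = trans (#-interval (s₀ + k) (s₀ + k + e) (m≤m+n (s₀ + k) e) (≤-trans head-tail≤end (end≤sum ns P)))
                   (m+n∸m≡n (s₀ + k) e)
    before-after-disjoint : ∀ v → Before v → After v → ⊥
    before-after-disjoint v (_ , hi) (lo , _) = <⇒≱ (<-≤-trans hi (≤-trans (m⊓n≤m s₀ m) (m≤m+n s₀ _))) lo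
    #-outer : #[ outer? ] ≡ m
    #-outer = begin
      #[ outer? ]                    ≡⟨ #-∪ before? after? before-after-disjoint ⟩
      #[ before? ] + #[ after? ]     ≡⟨ cong₂ _+_
           (#-interval 0 (s₀ ⊓ m) z≤n (≤-trans (m⊓n≤m s₀ m) (≤-trans (m≤m+n s₀ _) (end≤sum ns P))))
           (trans (#-interval e₀ (e₀ + (m ∸ s₀)) (m≤m+n e₀ _) outer≤sum) (m+n∸m≡n e₀ _)) ⟩
      s₀ ⊓ m + (m ∸ s₀)              ≡⟨ m⊓n+n∸m≡n s₀ m ⟩
      m                              ∎

  At : ℕ → Pred (Fin (sum ns)) 0ℓ
  At y v = y ≡ toℕ v ∸ s₀

  at? : ∀ y → Decidable (At y)
  at? y v = y ≟ toℕ v ∸ s₀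

  head-offset< : ∀ v → Head v → toℕ v ∸ s₀ < k
  head-offset< v (lo , hi) = +-cancelˡ-< s₀ _ _ (subst (_< s₀ + k) (sym (m+[n∸m]≡n lo)) hi)

  #-head-at : ∀ y → y < k → #[ head? ∩? at? y ] ≡ 1
  #-head-at y y<k = trans (#-cong (head? ∩? at? y) (interval? (s₀ + y) (suc (s₀ + y))) to from)
                          (trans (#-interval (s₀ + y) (suc (s₀ + y)) (n≤1+n _) (≤-trans (+-monoʳ-< s₀ y<k) (#-head≤sum)))
                                 (trans (cong (_∸ (s₀ + y)) (+-comm 1 (s₀ + y))) (m+n∸m≡n (s₀ + y) 1)))
    where
    #-head≤sum : s₀ + k ≤ sum ns
    #-head≤sum = ≤-trans (m≤m+n (s₀ + k) e) (≤-trans head-tail≤end (end≤sum ns P))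
    position : ∀ v → Head v → At y v → toℕ v ≡ s₀ + y
    position v (lo , _) y≡ = trans (sym (m+[n∸m]≡n lo)) (cong (s₀ +_) (sym y≡))
    to : ∀ v → Head v × At y v → Interval (s₀ + y) (suc (s₀ + y)) v
    to v (h , y≡) = ≤-reflexive (sym (position v h y≡)) , s≤s (≤-reflexive (position v h y≡))
    from : ∀ v → Interval (s₀ + y) (suc (s₀ + y)) v → Head v × At y v
    from v (lo , hi) = (≤-trans (m≤m+n s₀ y) lo , subst (_< s₀ + k) (sym v≡) (+-monoʳ-< s₀ y<k))
                     , sym (trans (cong (_∸ s₀) v≡) (m+n∸m≡n s₀ y))
      where
      v≡ : toℕ v ≡ s₀ + y
      v≡ = ≤-antisym (≤-pred hi) lo

  #-P-window : #[ inPart? ns P ∩? window? ] ≡ k + e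
  #-P-window = trans (#-cong (inPart? ns P ∩? window?) (interval? s₀ (s₀ + k + e)) to from)
                     (trans (#-interval s₀ (s₀ + k + e) (≤-trans (m≤m+n s₀ k) (m≤m+n _ e)) (≤-trans head-tail≤end (end≤sum ns P)))
                            (trans (cong (_∸ s₀) (+-assoc s₀ k e)) (m+n∸m≡n s₀ (k + e))))
    where
    to : ∀ v → InPart ns P v × Window v → Interval s₀ (s₀ + k + e) v
    to v (_ , inj₁ (lo , hi))             = lo , <-≤-trans hi (m≤m+n (s₀ + k) e)
    to v (_ , inj₂ (inj₁ (lo , hi)))      = ≤-trans (m≤m+n s₀ k) lo , hi
    to v (v∈P , inj₂ (inj₂ outer))        = ⊥-elim (outer-outside-P v outer v∈P)
    from : ∀ v → Interval s₀ (s₀ + k + e) v → InPart ns P v × Window v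
    from v (lo , hi) with toℕ v <? s₀ + k
    ... | yes in-head = head-in-P v (lo , in-head) , inj₁ (lo , in-head)
    ... | no  past    = tail-in-P v (≮⇒≥ past , hi) , inj₂ (inj₁ (≮⇒≥ past , hi))

  lists : Fin (sum ns) → List ℕ
  lists v with head? v
  ... | yes _ = k ∷ all-but k′ (toℕ v ∸ s₀)
  ... | no  _ with filler? v
  ...   | yes _ = upTo k
  ...   | no  _ = colours-from (suc k) k

  assignment : Assignment (K ns) k
  assignment = record { L = lists ; unique = lists-unique ; size = lists-size }
    where
    lists-unique : ∀ v → Unique (lists v)
    lists-unique v with head? v
    ... | yes _ = All.tabulate (λ j∈ k≡j → <-irrefl (sym k≡j) (proj₁ (∈-all-but⁻ j∈))) ∷ all-but-unique k′ (toℕ v ∸ s₀)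
    ... | no  _ with filler? v
    ...   | yes _ = upTo⁺ k
    ...   | no  _ = colours-from-unique (suc k) k
    lists-size : ∀ v → length (lists v) ≡ k
    lists-size v with head? v
    ... | yes _ = cong suc (all-but-length k′ (toℕ v ∸ s₀))
    ... | no  _ with filler? v
    ...   | yes _ = length-upTo k
    ...   | no  _ = colours-from-length (suc k) k

  list-colours : ∀ v {c} → c ∈ lists v →
                   (Head v × (c ≡ k ⊎ (c < k × c ≢ toℕ v ∸ s₀)))
                 ⊎ (Filler v × c < k)
                 ⊎ (¬ Window v × suc k ≤ c)
  list-colours v c∈ with head? v
  list-colours v (here c≡k) | yes h = inj₁ (h , inj₁ c≡k)
  list-colours v (there c∈) | yes h = inj₁ (h , inj₂ (∈-all-but⁻ c∈))
  list-colours v c∈         | no ¬h with filler? v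
  ... | yes fl  = inj₂ (inj₁ (fl , ∈-upTo⁻ c∈))
  ... | no  ¬fl = inj₂ (inj₂ ([ ¬h , ¬fl ]′ , ∈-colours-from⁻ c∈))

  k-on-head-lists : ∀ v → Head v → k ∈ lists v
  k-on-head-lists v h with head? v
  ... | yes _  = here refl
  ... | no  ¬h = ⊥-elim (¬h h)

  low-on-lists : ∀ v {j} → j < k → (Head v × j ≢ toℕ v ∸ s₀) ⊎ Filler v → j ∈ lists v
  low-on-lists v j<k on with head? v | on
  ... | yes h  | inj₁ (_ , j≢y) = there (∈-all-but⁺ (head-offset< v h) j<k j≢y)
  ... | yes h  | inj₂ fl        = ⊥-elim (head-not-filler v h fl)
  ... | no  ¬h | inj₁ (h , _)   = ⊥-elim (¬h h)
  ... | no  _  | inj₂ fl with filler? v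
  ...   | yes _   = ∈-upTo⁺ j<k
  ...   | no  ¬fl = ⊥-elim (¬fl fl)

  module _ (f : Fin (sum ns) → ℕ) (prop : IsProportionalLColoring assignment f) where
    open Proportional assignment f prop hiding (k)

    used-once-k : #[ colour? k ] ≡ 1
    used-once-k = used-once k (trans (#-cong (holders? k) head? on-head (λ v h → k-on-head-lists v h)) #-head)
      where
      on-head : ∀ v → k ∈ lists v → Head v
      on-head v k∈ with list-colours v k∈
      ... | inj₁ (h , _)               = h
      ... | inj₂ (inj₁ (_ , k<k))      = ⊥-elim (<-irrefl refl k<k)
      ... | inj₂ (inj₂ (_ , 1+k≤k))    = ⊥-elim (<-irrefl refl 1+k≤k)

    used-twice-low : ∀ j → j < k → #[ colour? j ] ≡ 2
    used-twice-low j j<k = used-twice j (begin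
      η assignment j                                 ≡⟨ #-cong (holders? j) holders-j? on-lists (λ v → low-on-lists v j<k) ⟩
      #[ holders-j? ]                                ≡⟨ #-∪ (head? ∩? ∁? (at? j)) filler? (λ v (h , _) fl → head-not-filler v h fl) ⟩
      #[ head? ∩? ∁? (at? j) ] + #[ filler? ]        ≡⟨ cong₂ _+_ #-head-not-at #-filler ⟩
      k′ + suc k                                     ≡⟨ +-suc k′ k ⟩
      k + k                                          ∎)
      where
      open ≡-Reasoning
      holders-j? : Decidable (λ v → (Head v × j ≢ toℕ v ∸ s₀) ⊎ Filler v)
      holders-j? = (head? ∩? ∁? (at? j)) ∪? filler?
      on-lists : ∀ v → j ∈ lists v → (Head v × j ≢ toℕ v ∸ s₀) ⊎ Filler v
      on-lists v j∈ with list-colours v j∈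
      ... | inj₁ (h , inj₁ j≡k)       = ⊥-elim (<-irrefl j≡k j<k)
      ... | inj₁ (h , inj₂ (_ , j≢y)) = inj₁ (h , j≢y)
      ... | inj₂ (inj₁ (fl , _))      = inj₂ fl
      ... | inj₂ (inj₂ (_ , 1+k≤j))   = ⊥-elim (<⇒≱ j<k (≤-trans (n≤1+n k) 1+k≤j))
      #-head-not-at : #[ head? ∩? ∁? (at? j) ] ≡ k′
      #-head-not-at = suc-injective (trans (sym (trans (#-split head? (at? j)) (cong (_+ #[ head? ∩? ∁? (at? j) ]) (#-head-at j j<k)))) #-head)

    low-in-window : ∀ v → f v < k → Window v
    low-in-window v low with list-colours v (list-coloured v)
    ... | inj₁ (h , _)              = inj₁ h
    ... | inj₂ (inj₁ (fl , _))      = inj₂ fl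
    ... | inj₂ (inj₂ (_ , 1+k≤fv))  = ⊥-elim (<⇒≱ low (≤-trans (n≤1+n k) 1+k≤fv))

    -- In the window, a colour ≥ k can only be k itself, which sits on the head.
    one-high : #[ (inPart? ns P ∩? window?) ∩? ∁? (below? k) ] ≡ 1
    one-high = trans (#-cong ((inPart? ns P ∩? window?) ∩? ∁? (below? k)) (colour? k) to from) used-once-k
      where
      to : ∀ v → (InPart ns P v × Window v) × ¬ f v < k → f v ≡ k
      to v ((_ , w) , high) with list-colours v (list-coloured v)
      ... | inj₁ (_ , inj₁ fv≡k)      = fv≡k
      ... | inj₁ (_ , inj₂ (low , _)) = ⊥-elim (high low)
      ... | inj₂ (inj₁ (_ , low))     = ⊥-elim (high low)
      ... | inj₂ (inj₂ (¬w , _))      = ⊥-elim (¬w w)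
      from : ∀ v → f v ≡ k → (InPart ns P v × Window v) × ¬ f v < k
      from v fv≡k with list-colours v (subst (_∈ lists v) fv≡k (list-coloured v))
      ... | inj₁ (h , _)             = (head-in-P v h , inj₁ h) , λ low → <-irrefl fv≡k low
      ... | inj₂ (inj₁ (_ , k<k))    = ⊥-elim (<-irrefl refl k<k)
      ... | inj₂ (inj₂ (_ , 1+k≤k))  = ⊥-elim (<-irrefl refl 1+k≤k)

    contradiction : ⊥
    contradiction = parity-obstruction ns proper k used-twice-low P window? low-in-window
                      (subst (2 ∣_) (sym #-P-window) even) one-high

  not-choosable : ¬ ProportionallyChoosable (K ns) k
  not-choosable choosable = contradiction (proj₁ (choosable assignment)) (proj₂ (choosable assignment))

not-0-choosable : ∀ {t} (ns : Vec ℕ t) → 0 < sum ns → ¬ ProportionallyChoosable (K ns) 0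
not-0-choosable ns nonempty choosable with proj₁ (proj₁ (proj₂ (choosable no-colours))) (fromℕ< nonempty)
  where
  no-colours : Assignment (K ns) 0
  no-colours = record { L = λ _ → [] ; unique = λ _ → [] ; size = λ _ → refl }
... | ()

-- For k ≥ 1 either all parts have at most k vertices (first construction) or some
-- part P has more, and then e ∈ {0, 1} is chosen so that k + e is even.
not-choosable-up-to : ∀ {t} (ns : Vec ℕ t) s → sum ns ≡ s + s → 0 < sum ns →
                      (∀ i → 2 ∣ lookup ns i) → (∀ i → lookup ns i ≤ s) →
                      ∀ k → k ≤ s → ¬ ProportionallyChoosable (K ns) k
not-choosable-up-to ns s N≡2s nonempty even bound zero _ = not-0-choosable ns nonempty
not-choosable-up-to ns s N≡2s nonempty even bound (suc k′) k≤s = by-size (any? (λ i → suc k′ <? lookup ns i))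
  where
  -- At least s vertices lie outside any part.
  outside : ∀ {m} P → m ≤ lookup ns P → m + lookup ns P ≤ sum ns
  outside {m} P m≤nP = subst (m + lookup ns P ≤_) (sym N≡2s) (+-mono-≤ (≤-trans m≤nP (bound P)) (bound P))

  big-part : ∀ P → suc k′ < lookup ns P → ¬ ProportionallyChoosable (K ns) (suc k′)
  big-part P k<nP with even-or-odd (suc k′)
  ... | inj₁ 2∣k   = BigPart.not-choosable ns P k′ 0 (suc (suc k′)) refl
                       (subst (_≤ lookup ns P) (sym (+-identityʳ _)) (<⇒≤ k<nP)) (outside P k<nP)
                       (subst (2 ∣_) (sym (+-identityʳ _)) 2∣k)
  ... | inj₂ 2∣k+1 = BigPart.not-choosable ns P k′ 1 (suc k′) refl
                       (subst (_≤ lookup ns P) (+-comm 1 (suc k′)) k<nP) (outside P (<⇒≤ k<nP))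
                       (subst (2 ∣_) (+-comm 1 (suc k′)) 2∣k+1)

  by-size : Dec (∃ λ i → suc k′ < lookup ns i) → ¬ ProportionallyChoosable (K ns) (suc k′)
  by-size (yes (P , k<nP)) = big-part P k<nP
  by-size (no none)        = SmallParts.not-choosable ns k′ (λ i → ≮⇒≥ (λ k<nᵢ → none (i , k<nᵢ))) even
                               (subst (suc k′ + suc k′ ≤_) (sym N≡2s) (+-mono-≤ k≤s k≤s))

twice-half : ∀ {n} → 2 ∣ n → n / 2 + n / 2 ≡ n
twice-half {n} 2∣n = trans (cong (n / 2 +_) (sym (+-identityʳ (n / 2)))) (m*[n/m]≡n 2∣n)

sum-halves : ∀ {t} (ns : Vec ℕ t) → (∀ i → 2 ∣ lookup ns i) →
             sum ns ≡ sum (map (λ n → n / 2) ns) + sum (map (λ n → n / 2) ns)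
sum-halves []       even = refl
sum-halves (n ∷ ns) even = begin
  n + sum ns                                 ≡⟨ cong₂ _+_ (sym (twice-half (even fzero))) (sum-halves ns (λ i → even (fsuc i))) ⟩
  (n / 2 + n / 2) + (half-sum + half-sum)    ≡⟨ interchange (n / 2) (n / 2) half-sum half-sum ⟩
  (n / 2 + half-sum) + (n / 2 + half-sum)    ∎
  where
  open ≡-Reasoning
  half-sum : ℕ
  half-sum = sum (map (λ n → n / 2) ns)

proposition8 : (t : ℕ) → (ns : Vec ℕ t) → 2 ≤ t →
    (∀ i → 1 ≤ lookup ns i) → (∀ i → 2 ∣ lookup ns i) →
    (∀ i → lookup ns i ≤ sum (map (λ n → n / 2) ns)) →
    ¬ ProportionallyChoosable (K ns) (sum (map (λ n → n / 2) ns))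
    × χpc≥ (K ns) (suc (sum (map (λ n → n / 2) ns)))
proposition8 zero    []       ()
proposition8 (suc t) (n ∷ ns) _ nonempty even bound = not-up-to s ≤-refl , at-least
  where
  s : ℕ
  s = sum (map (λ n → n / 2) (n ∷ ns))
  not-up-to : ∀ k → k ≤ s → ¬ ProportionallyChoosable (K (n ∷ ns)) k
  not-up-to = not-choosable-up-to (n ∷ ns) s (sum-halves (n ∷ ns) even)
                (≤-trans (nonempty fzero) (m≤m+n n (sum ns))) even bound
  at-least : χpc≥ (K (n ∷ ns)) (suc s)
  at-least k choosable = ≰⇒> (λ k≤s → not-up-to k k≤s choosable)
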